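{- Let $T = (V,E)$ be a finite simple undirected tree. For all $u,v \in V$ with $\mathrm{dist}(u,v) \geq 3$, the inequality $$x_{uv} + x_{\vec{u}(v),\vec{v}(u)} \leq x_{u,\vec{v}(u)} + x_{\vec{u}(v),v}$$ is valid for $\Xi_T$.
   Context: Let $m = |\binom{V}{2}|$. Vectors $x \in \mathbb{R}^m$ have coordinates $x_{uv} = x_{vu}$ indexed by unordered pairs of distinct nodes; for an edge $e = \{u,v\} \in E$ write $x_e = x_{uv}$. $P_{uv}$ is the unique path in $T$ from $u$ to $v$ and $\mathrm{dist}(u,v)$ its number of edges. $X_T$ is the set of all $x \in \{0,1\}^m$ such that for all $u,v$ with $\mathrm{dist}(u,v) \geq 2$: $x_{uv} \leq \sum_{e \in P_{uv}} x_e$, and $x_e \leq x_{uv}$ for every $e \in P_{uv}$. The lifted multicut polytope is $\Xi_T = \operatorname{conv} X_T$. For $u,v$ with $\mathrm{dist}(u,v) \geq 2$, $\vec{u}(v)$ denotes the neighbor of $u$ on $P_{uv}$ and $\vec{v}(u)$ the neighbor of $v$ on $P_{uv}$.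
   Formalization: Validity is claimed only for the points of $\Xi_T$ that are convex combinations of points of $X_T$ with rational coefficients, rather than for every point of conv X_T. -}

module Defs where

open import Level using (0ℓ)
open import Data.Nat as ℕ using (ℕ)
open import Data.Fin using (Fin)
open import Data.Integer using (+_)
open import Data.Rational as ℚ using (ℚ; 0ℚ; 1ℚ; _/_)
open import Data.List using (List; []; _∷_; length; head; last; foldr; map)
open import Data.List.Relation.Unary.All using (All)
open import Data.List.Relation.Unary.Unique.Propositional using (Unique)
open import Data.Maybe using (just)
open import Data.Product using (_×_; _,_; ∃; ∃-syntax; Σ-syntax)
open import Relation.Binary.PropositionalEquality using (_≡_)
open import Relation.Nullary using (¬_)

record SimpleGraph (n : ℕ) : Set₁ where
  field
    Adj     : Fin n → Fin n → Set
    sym     : ∀ {u v} → Adj u v → Adj v u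
    irrefl  : ∀ {u} → ¬ Adj u u

edges : {A : Set} → List A → List (A × A)
edges (a ∷ b ∷ rest) = (a , b) ∷ edges (b ∷ rest)
edges _              = []

module _ {n : ℕ} (G : SimpleGraph n) where
  open SimpleGraph G

  Walk : List (Fin n) → Set
  Walk p = All (λ e → Adj (Data.Product.proj₁ e) (Data.Product.proj₂ e)) (edges p)

  IsPath : Fin n → Fin n → List (Fin n) → Set
  IsPath u v p = (head p ≡ just u) × (last p ≡ just v) × Unique p × Walk p

  IsCycle : List (Fin n) → Set
  IsCycle c = (3 ℕ.≤ length c) × Unique c × Walk c
            × (∃[ a ] ∃[ b ] (head c ≡ just a × last c ≡ just b × Adj b a))

  Connected : Set
  Connected = ∀ u v → ∃[ p ] IsPath u v p

  Acyclic : Set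
  Acyclic = ∀ c → ¬ IsCycle c

IsTree : {n : ℕ} → SimpleGraph n → Set
IsTree G = Connected G × Acyclic G

-- Points x ∈ ℝ^m are represented as functions on ordered pairs which are
-- symmetric; the (meaningless) diagonal is fixed to 0.
Pt : ℕ → Set
Pt n = Fin n → Fin n → ℕ

sumEdges : {n : ℕ} → Pt n → List (Fin n) → ℕ
sumEdges x p = foldr (λ e s → x (Data.Product.proj₁ e) (Data.Product.proj₂ e) ℕ.+ s) 0 (edges p)

-- x ∈ X_T  (dist(u,v) = number of edges of the unique u-v path p)
InX : {n : ℕ} → SimpleGraph n → Pt n → Set
InX {n} T x =
    (∀ u v → x u v ℕ.≤ 1)
  × (∀ u v → x u v ≡ x v u)
  × (∀ u → x u u ≡ 0)
  × (∀ u v p → IsPath T u v p → 2 ℕ.≤ length (edges p) →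
        (x u v ℕ.≤ sumEdges x p)
      × All (λ e → x (Data.Product.proj₁ e) (Data.Product.proj₂ e) ℕ.≤ x u v) (edges p))

toℚ : ℕ → ℚ
toℚ k = (+ k) / 1

sumℚ : List ℚ → ℚ
sumℚ = foldr ℚ._+_ 0ℚ

combine : {n : ℕ} → List (ℚ × Pt n) → Fin n → Fin n → ℚ
combine cs u v = sumℚ (map (λ wx → Data.Product.proj₁ wx ℚ.* toℚ (Data.Product.proj₂ wx u v)) cs)

-- y is (the coordinate function of) a point of Ξ_T = conv X_T
-- (with rational convex coefficients)
InΞ : {n : ℕ} → SimpleGraph n → (Fin n → Fin n → ℚ) → Set
InΞ {n} T y = ∃[ cs ] ( All (λ wx → InX T (Data.Product.proj₂ wx)) cs
                      × All (λ wx → 0ℚ ℚ.≤ Data.Product.proj₁ wx) cs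
                      × sumℚ (map Data.Product.proj₁ cs) ≡ 1ℚ
                      × (∀ u v → y u v ≡ combine cs u v) )

-- On a 0/1 point x the inequality is a statement about cut edges of the path
-- u, a, …, b, v: along any path, the endpoint coordinate is at most the sum of
-- x over the path's edges and at least each of them.  If x_ab = 1, some edge
-- of the a–b path is cut; it lies on both the u–b and the a–v path, so
-- x_ub = x_av = 1.  If x_ab = 0 and x_uv = 1, a cut edge of the u–v path is
-- either {u,a}, which lies on the u–b path, or lies on the a–v path.  The
-- inequality is linear and homogeneous, so it passes to nonnegative
-- combinations of such points.
module Submission where

open import Defs
open import Data.Nat using (ℕ)
open import Data.Fin using (Fin)
open import Data.List using (List; []; _∷_; _++_)
open import Data.Rational using (ℚ; _+_; _≤_)

import Data.Nat as ℕ
import Data.Nat.Properties as ℕ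
import Data.Integer as ℤ
import Data.Integer.Properties as ℤ
import Data.Rational as ℚ
import Data.Rational.Properties as ℚ
import Data.Rational.Unnormalised as ℚᵘ
import Data.Rational.Unnormalised.Properties as ℚᵘ
open import Algebra.Bundles using (CommutativeMonoid)
open import Algebra.Properties.CommutativeSemigroup
  (CommutativeMonoid.commutativeSemigroup ℚ.+-0-commutativeMonoid) using (interchange)
open import Data.List using (head; last; length; map; foldr)
open import Data.List.Relation.Unary.All as All using (All; []; _∷_)
open import Data.List.Relation.Unary.All.Properties using (++⁺; ++⁻ˡ; ++⁻ʳ)
open import Data.List.Relation.Unary.AllPairs using (AllPairs; []; _∷_)
open import Data.List.Relation.Unary.Any using (Any; here; there)
open import Data.Maybe using (just)
open import Data.Product using (_×_; _,_; proj₁; proj₂)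
open import Data.Sum using (_⊎_; inj₁; inj₂)
open import Relation.Binary.PropositionalEquality
  using (_≡_; refl; sym; trans; cong; cong₂; subst; module ≡-Reasoning)

module _ {A : Set} where

  head-++-∷ : ∀ xs {w : A} ys zs → head (xs ++ w ∷ ys) ≡ head (xs ++ w ∷ zs)
  head-++-∷ []      _ _ = refl
  head-++-∷ (_ ∷ _) _ _ = refl

  last-∷ʳ : ∀ xs {w : A} → last (xs ++ w ∷ []) ≡ just w
  last-∷ʳ []           = refl
  last-∷ʳ (_ ∷ [])     = refl
  last-∷ʳ (_ ∷ y ∷ ys) = last-∷ʳ (y ∷ ys)

  All-truncate : ∀ {P : A → Set} xs {w ys} → All P (xs ++ w ∷ ys) → All P (xs ++ w ∷ [])
  All-truncate xs h = ++⁺ (++⁻ˡ xs h) (All.head (++⁻ʳ xs h) ∷ [])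

  AllPairs-truncate : ∀ {R : A → A → Set} xs {w ys} →
                      AllPairs R (xs ++ w ∷ ys) → AllPairs R (xs ++ w ∷ [])
  AllPairs-truncate []       (_ ∷ _)    = [] ∷ []
  AllPairs-truncate (_ ∷ xs) (px ∷ pxs) = All-truncate xs px ∷ AllPairs-truncate xs pxs

  edges-truncate : ∀ {P : A × A → Set} xs {w ys} →
                   All P (edges (xs ++ w ∷ ys)) → All P (edges (xs ++ w ∷ []))
  edges-truncate []           _        = []
  edges-truncate (_ ∷ [])     (p ∷ _)  = p ∷ []
  edges-truncate (_ ∷ y ∷ ys) (p ∷ ps) = p ∷ edges-truncate (y ∷ ys) ps

  module _ (f : A → ℕ) where

    foldr-+-positive : ∀ as → 1 ℕ.≤ foldr (λ a s → f a ℕ.+ s) 0 as → Any (λ a → 1 ℕ.≤ f a) as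
    foldr-+-positive (a ∷ as) h with f a in fa≡
    ... | ℕ.zero  = there (foldr-+-positive as h)
    ... | ℕ.suc _ = here (subst (1 ℕ.≤_) (sym fa≡) (ℕ.s≤s ℕ.z≤n))

    Any-≤-All : ∀ {m c as} → Any (λ a → m ℕ.≤ f a) as → All (λ a → f a ℕ.≤ c) as → m ℕ.≤ c
    Any-≤-All m≤ ≤c = let (f≤c , m≤f) = All.lookupAny ≤c m≤ in ℕ.≤-trans m≤f f≤c

module _ {n : ℕ} (T : SimpleGraph n) where

  IsPath-tail : ∀ {u v a p} → IsPath T u v (u ∷ a ∷ p) → IsPath T a v (a ∷ p)
  IsPath-tail (refl , last≡ , _ ∷ unique , _ ∷ walk) = refl , last≡ , unique , walk

  IsPath-truncate : ∀ {u v} xs {w ys} → IsPath T u v (xs ++ w ∷ ys) → IsPath T u w (xs ++ w ∷ [])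
  IsPath-truncate xs {ys = ys} (head≡ , _ , unique , walk) =
    trans (head-++-∷ xs [] ys) head≡ , last-∷ʳ xs ,
    AllPairs-truncate xs unique , edges-truncate xs walk

edgeValue : {n : ℕ} → Pt n → Fin n × Fin n → ℕ
edgeValue x e = x (proj₁ e) (proj₂ e)

+-≤-of-cuts : ∀ {m k p q} → m ℕ.≤ 1 → k ℕ.≤ 1 →
              (1 ℕ.≤ m → 1 ℕ.≤ p ⊎ 1 ℕ.≤ q) → (1 ℕ.≤ k → 1 ℕ.≤ p × 1 ℕ.≤ q) →
              m ℕ.+ k ℕ.≤ p ℕ.+ q
+-≤-of-cuts ℕ.z≤n ℕ.z≤n _ _ = ℕ.z≤n
+-≤-of-cuts {p = p} {q} (ℕ.s≤s ℕ.z≤n) ℕ.z≤n m-cut _ with m-cut ℕ.≤-refl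
... | inj₁ 1≤p = ℕ.≤-trans 1≤p (ℕ.m≤m+n p q)
... | inj₂ 1≤q = ℕ.≤-trans 1≤q (ℕ.m≤n+m q p)
+-≤-of-cuts m≤1 (ℕ.s≤s ℕ.z≤n) _ k-cut =
  ℕ.+-mono-≤ (ℕ.≤-trans m≤1 (proj₁ (k-cut ℕ.≤-refl))) (proj₂ (k-cut ℕ.≤-refl))

-- The lifted constraints of X_T only mention paths with at least two edges;
-- on shorter paths they hold because of the diagonal x_ss = 0.
module _ {n : ℕ} {T : SimpleGraph n} {x : Pt n} (x∈X : InX T x) where

  x≤1 : ∀ s t → x s t ℕ.≤ 1
  x≤1 = proj₁ x∈X

  x-diag : ∀ s → x s s ≡ 0
  x-diag = proj₁ (proj₂ (proj₂ x∈X))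

  lifted : ∀ {s t} p → IsPath T s t p → 2 ℕ.≤ length (edges p) →
           (x s t ℕ.≤ sumEdges x p) × All (λ e → edgeValue x e ℕ.≤ x s t) (edges p)
  lifted p = proj₂ (proj₂ (proj₂ x∈X)) _ _ p

  ≤-sumEdges : ∀ {s t} p → IsPath T s t p → x s t ℕ.≤ sumEdges x p
  ≤-sumEdges (_ ∷ [])         (refl , refl , _) = ℕ.≤-reflexive (x-diag _)
  ≤-sumEdges (_ ∷ _ ∷ [])     (refl , refl , _) = ℕ.m≤m+n _ 0
  ≤-sumEdges p@(_ ∷ _ ∷ _ ∷ _) path             = proj₁ (lifted p path (ℕ.s≤s (ℕ.s≤s ℕ.z≤n)))

  edgeValue-≤ : ∀ {s t} p → IsPath T s t p → All (λ e → edgeValue x e ℕ.≤ x s t) (edges p)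
  edgeValue-≤ (_ ∷ [])         _                 = []
  edgeValue-≤ (_ ∷ _ ∷ [])     (refl , refl , _) = ℕ.≤-refl ∷ []
  edgeValue-≤ p@(_ ∷ _ ∷ _ ∷ _) path             = proj₂ (lifted p path (ℕ.s≤s (ℕ.s≤s ℕ.z≤n)))

  cut-edge : ∀ {s t} p → IsPath T s t p → 1 ℕ.≤ x s t → Any (λ e → 1 ℕ.≤ edgeValue x e) (edges p)
  cut-edge p path 1≤x = foldr-+-positive (edgeValue x) (edges p) (ℕ.≤-trans 1≤x (≤-sumEdges p path))

  exchange-≤ : ∀ {u a} mid {b v} → IsPath T u v (u ∷ a ∷ mid ++ b ∷ v ∷ []) →
               x u v ℕ.+ x a b ℕ.≤ x u b ℕ.+ x a v
  exchange-≤ {u} {a} mid {b} {v} uv-path = +-≤-of-cuts (x≤1 u v) (x≤1 a b) uv-cut ab-cut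
    where
    av-path : IsPath T a v (a ∷ mid ++ b ∷ v ∷ [])
    av-path = IsPath-tail T uv-path

    ub-bound : All (λ e → edgeValue x e ℕ.≤ x u b) (edges (u ∷ a ∷ mid ++ b ∷ []))
    ub-bound = edgeValue-≤ _ (IsPath-truncate T (u ∷ a ∷ mid) uv-path)

    av-bound : All (λ e → edgeValue x e ℕ.≤ x a v) (edges (a ∷ mid ++ b ∷ v ∷ []))
    av-bound = edgeValue-≤ _ av-path

    uv-cut : 1 ℕ.≤ x u v → 1 ℕ.≤ x u b ⊎ 1 ℕ.≤ x a v
    uv-cut 1≤x with cut-edge _ uv-path 1≤x
    ... | here 1≤xua = inj₁ (ℕ.≤-trans 1≤xua (All.head ub-bound))
    ... | there cut  = inj₂ (Any-≤-All (edgeValue x) cut av-bound)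

    ab-cut : 1 ℕ.≤ x a b → 1 ℕ.≤ x u b × 1 ℕ.≤ x a v
    ab-cut 1≤x = Any-≤-All (edgeValue x) cut (All.tail ub-bound)
               , Any-≤-All (edgeValue x) cut (edges-truncate (a ∷ mid) av-bound)
      where
      cut : Any (λ e → 1 ℕ.≤ edgeValue x e) (edges (a ∷ mid ++ b ∷ []))
      cut = cut-edge _ (IsPath-truncate T (a ∷ mid) av-path) 1≤x

ℕ→ℚᵘ : ℕ → ℚᵘ.ℚᵘ
ℕ→ℚᵘ k = ℚᵘ.mkℚᵘ (ℤ.+ k) 0

-- toℚ k is by definition ℚ.fromℚᵘ (ℕ→ℚᵘ k).
toℚᵘ-toℚ : ∀ k → ℚ.toℚᵘ (toℚ k) ℚᵘ.≃ ℕ→ℚᵘ k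
toℚᵘ-toℚ k = ℚ.toℚᵘ-fromℚᵘ (ℕ→ℚᵘ k)

toℚ-homo-+ : ∀ m k → toℚ (m ℕ.+ k) ≡ toℚ m + toℚ k
toℚ-homo-+ m k = ℚ.toℚᵘ-injective (begin-equality
  ℚ.toℚᵘ (toℚ (m ℕ.+ k))                   ≃⟨ toℚᵘ-toℚ (m ℕ.+ k) ⟩
  ℕ→ℚᵘ (m ℕ.+ k)                           ≃⟨ ℚᵘ.*≡* (cong (ℤ._* ℤ.1ℤ) +m+k≡) ⟩
  ℕ→ℚᵘ m ℚᵘ.+ ℕ→ℚᵘ k                       ≃⟨ ℚᵘ.+-cong (toℚᵘ-toℚ m) (toℚᵘ-toℚ k) ⟨
  ℚ.toℚᵘ (toℚ m) ℚᵘ.+ ℚ.toℚᵘ (toℚ k)       ≃⟨ ℚ.toℚᵘ-homo-+ (toℚ m) (toℚ k) ⟨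
  ℚ.toℚᵘ (toℚ m + toℚ k)                   ∎)
  where
  open ℚᵘ.≤-Reasoning
  +m+k≡ : ℤ.+ (m ℕ.+ k) ≡ ℤ.+ m ℤ.* ℤ.1ℤ ℤ.+ ℤ.+ k ℤ.* ℤ.1ℤ
  +m+k≡ = trans (ℤ.pos-+ m k) (sym (cong₂ ℤ._+_ (ℤ.*-identityʳ (ℤ.+ m)) (ℤ.*-identityʳ (ℤ.+ k))))

toℚ-mono-≤ : ∀ {m k} → m ℕ.≤ k → toℚ m ≤ toℚ k
toℚ-mono-≤ {m} {k} m≤k = ℚ.toℚᵘ-cancel-≤ (begin
  ℚ.toℚᵘ (toℚ m) ≃⟨ toℚᵘ-toℚ m ⟩
  ℕ→ℚᵘ m         ≤⟨ ℚᵘ.*≤* (ℤ.*-monoʳ-≤-nonNeg ℤ.1ℤ (ℤ.+≤+ m≤k)) ⟩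
  ℕ→ℚᵘ k         ≃⟨ toℚᵘ-toℚ k ⟨
  ℚ.toℚᵘ (toℚ k) ∎)
  where open ℚᵘ.≤-Reasoning

weightedSum : {A : Set} → List (ℚ × A) → (A → ℚ) → ℚ
weightedSum cs f = sumℚ (map (λ wa → proj₁ wa ℚ.* f (proj₂ wa)) cs)

module _ {A : Set} where

  weightedSum-+ : ∀ (cs : List (ℚ × A)) f g →
                  weightedSum cs f + weightedSum cs g ≡ weightedSum cs (λ a → f a + g a)
  weightedSum-+ []             _ _ = refl
  weightedSum-+ ((w , a) ∷ cs) f g = begin
    (w ℚ.* f a + Sf) + (w ℚ.* g a + Sg)   ≡⟨ interchange (w ℚ.* f a) Sf (w ℚ.* g a) Sg ⟩
    (w ℚ.* f a + w ℚ.* g a) + (Sf + Sg)   ≡⟨ cong₂ _+_ (sym (ℚ.*-distribˡ-+ w (f a) (g a))) (weightedSum-+ cs f g) ⟩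
    w ℚ.* (f a + g a) + weightedSum cs _  ∎
    where
    open ≡-Reasoning
    Sf Sg : ℚ
    Sf = weightedSum cs f
    Sg = weightedSum cs g

  weightedSum-mono-≤ : ∀ {cs : List (ℚ × A)} {f g} → All (λ wa → ℚ.0ℚ ≤ proj₁ wa) cs →
                       All (λ wa → f (proj₂ wa) ≤ g (proj₂ wa)) cs →
                       weightedSum cs f ≤ weightedSum cs g
  weightedSum-mono-≤ []           []           = ℚ.≤-refl
  weightedSum-mono-≤ {(w , _) ∷ _} (w≥0 ∷ ws≥0) (f≤g ∷ fs≤gs) =
    ℚ.+-mono-≤ (ℚ.*-monoˡ-≤-nonNeg w {{ℚ.nonNegative w≥0}} f≤g) (weightedSum-mono-≤ ws≥0 fs≤gs)

lemma8 : ∀ {n : ℕ} (T : SimpleGraph n) → IsTree T →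
         ∀ (u a : Fin n) (mid : List (Fin n)) (b v : Fin n) →
         IsPath T u v (u ∷ a ∷ mid ++ (b ∷ v ∷ [])) →
         ∀ (y : Fin n → Fin n → ℚ) → InΞ T y →
         y u v + y a b ≤ y u b + y a v
lemma8 T _ u a mid b v uv-path y (cs , cs⊆X , cs≥0 , _ , y≡) = begin
  y u v + y a b                                    ≡⟨ cong₂ _+_ (y≡ u v) (y≡ a b) ⟩
  combine cs u v + combine cs a b                  ≡⟨ weightedSum-+ cs (λ x → toℚ (x u v)) (λ x → toℚ (x a b)) ⟩
  weightedSum cs (λ x → toℚ (x u v) + toℚ (x a b)) ≤⟨ weightedSum-mono-≤ cs≥0 (All.map exchangeℚ cs⊆X) ⟩
  weightedSum cs (λ x → toℚ (x u b) + toℚ (x a v)) ≡⟨ weightedSum-+ cs (λ x → toℚ (x u b)) (λ x → toℚ (x a v)) ⟨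
  combine cs u b + combine cs a v                  ≡⟨ cong₂ _+_ (y≡ u b) (y≡ a v) ⟨
  y u b + y a v                                    ∎
  where
  open ℚ.≤-Reasoning
  exchangeℚ : ∀ {x} → InX T x → toℚ (x u v) + toℚ (x a b) ≤ toℚ (x u b) + toℚ (x a v)
  exchangeℚ {x} x∈X = begin
    toℚ (x u v) + toℚ (x a b) ≡⟨ toℚ-homo-+ (x u v) (x a b) ⟨
    toℚ (x u v ℕ.+ x a b)     ≤⟨ toℚ-mono-≤ (exchange-≤ {T = T} x∈X mid uv-path) ⟩
    toℚ (x u b ℕ.+ x a v)     ≡⟨ toℚ-homo-+ (x u b) (x a v) ⟩
    toℚ (x u b) + toℚ (x a v) ∎
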